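{- Let $P$ be a finite poset, fix $\alpha^{\mathrm{B}},\omega^{\mathrm{B}}\in\mathbb{R}_{>0}$, and let $\mathcal{O}$ be a finite orbit of $\mathrm{row}^{\mathrm{B}}\colon\mathbb{R}_{>0}^P\to\mathbb{R}_{>0}^P$. Then for every $p\in P$, $\prod_{f\in\mathcal{O}}\mathcal{T}^{\mathrm{B}}_p(f)=1$.
   Context: Let $\widehat P$ be $P$ with a new minimum $\widehat0$ and maximum $\widehat1$; each $f\in\mathbb{R}_{>0}^P$ is regarded as a function on $\widehat P$ with $f(\widehat0)=\alpha^{\mathrm{B}}$, $f(\widehat1)=\omega^{\mathrm{B}}$. The birational toggle $\tau^{\mathrm{B}}_p\colon\mathbb{R}_{>0}^P\to\mathbb{R}_{>0}^P$ leaves $f(q)$ unchanged for $q\neq p$ and replaces $f(p)$ by $\dfrac{1}{f(p)}\cdot\dfrac{\sum_{x\in\widehat P:\,p\text{ covers }x}f(x)}{\sum_{x\in\widehat P:\,x\text{ covers }p}1/f(x)}$. Birational rowmotion is $\mathrm{row}^{\mathrm{B}}=\tau^{\mathrm{B}}_{p_1}\circ\tau^{\mathrm{B}}_{p_2}\circ\cdots\circ\tau^{\mathrm{B}}_{p_N}$ for any linear extension $p_1,\ldots,p_N$ of $P$ (independent of the choice). Define $\mathcal{T}^{\mathrm{B}}_{p^+}(f)=f(p)\big/\sum_{q\in\widehat P:\,p\text{ covers }q}f(q)$, $\mathcal{T}^{\mathrm{B}}_{p^- }(f)=\dfrac{1}{f(p)}\cdot\dfrac{1}{\sum_{q\in\widehat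 P:\,q\text{ covers }p}1/f(q)}$, and $\mathcal{T}^{\mathrm{B}}_p(f)=\mathcal{T}^{\mathrm{B}}_{p^+}(f)/\mathcal{T}^{\mathrm{B}}_{p^- }(f)$. -}

module Defs where

open import Level using (0ℓ)
open import Data.Nat using (ℕ; zero; suc)
open import Data.Bool using (Bool; true; false; _∧_; not; if_then_else_) renaming (_≟_ to _≟ᵇ_)
open import Data.Bool.ListAction using (any)
open import Data.Fin using (Fin) renaming (_<_ to _<ᶠ_)
open import Data.Fin.Properties using () renaming (_≟_ to _≟ᶠ_)
open import Data.Fin.Permutation using (Permutation′; _⟨$⟩ʳ_)
open import Data.List using (List; []; _∷_; filter; foldr; map; allFin)
open import Data.Product using (Σ; ∃; _×_; _,_)
open import Data.Sum using (_⊎_)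
open import Function using (id; _∘_)
open import Relation.Nullary using (¬_; Dec; yes; no)
open import Relation.Nullary.Decidable using (⌊_⌋)
open import Relation.Binary using (Rel)
open import Relation.Binary.Structures using (IsDecPartialOrder; IsStrictTotalOrder)
open import Relation.Binary.PropositionalEquality using (_≡_)
open import Algebra.Structures using (IsCommutativeRing)

-- An axiomatic model of the real numbers: a complete (least-upper-bound)
-- linearly ordered field.  Any such structure is isomorphic to ℝ.
-- Inversion is total; the inverse axiom is required only for x ≢ 0.

record RealField : Set₁ where
  infixl 6 _+_
  infixl 7 _*_
  infix 4 _<_ _≤_
  field
    Carrier : Set
    _+_ _*_ : Carrier → Carrier → Carrier
    -_ : Carrier → Carrier
    _⁻¹ : Carrier → Carrier
    0# 1# : Carrier
    _<_ : Rel Carrier 0ℓ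
    isCommutativeRing : IsCommutativeRing _≡_ _+_ _*_ -_ 0# 1#
    0≢1 : ¬ (0# ≡ 1#)
    ⁻¹-inverse : ∀ x → ¬ (x ≡ 0#) → x * (x ⁻¹) ≡ 1#
    isStrictTotalOrder : IsStrictTotalOrder _≡_ _<_
    +-mono-< : ∀ {x y} z → x < y → x + z < y + z
    *-pos : ∀ {x y} → 0# < x → 0# < y → 0# < x * y

  _≤_ : Rel Carrier 0ℓ
  x ≤ y = x < y ⊎ x ≡ y

  field
    complete : (S : Carrier → Set) → (∃ λ x → S x) →
               (∃ λ b → ∀ x → S x → x ≤ b) →
               ∃ λ s → (∀ x → S x → x ≤ s) ×
                       (∀ b → (∀ x → S x → x ≤ b) → s ≤ b)

module Rowmotion (R : RealField) {n : ℕ}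
                 (_≼_ : Rel (Fin n) 0ℓ)
                 (isDPO : IsDecPartialOrder _≡_ _≼_)
                 (α ω : RealField.Carrier R) where

  open RealField R
  open IsDecPartialOrder isDPO using () renaming (_≤?_ to _≼?_)

  lt : Fin n → Fin n → Bool
  lt x y = ⌊ x ≼? y ⌋ ∧ not ⌊ x ≟ᶠ y ⌋

  covers : Fin n → Fin n → Bool
  covers p x = lt x p ∧ not (any (λ z → lt x z ∧ lt z p) (allFin n))

  -- p covers 0̂ in P̂ iff p is minimal in P; 1̂ covers p iff p is maximal
  minimal maximal : Fin n → Bool
  minimal p = not (any (λ x → lt x p) (allFin n))
  maximal p = not (any (λ x → lt p x) (allFin n))

  lowerCovers upperCovers : Fin n → List (Fin n)
  lowerCovers p = filter (λ x → covers p x ≟ᵇ true) (allFin n)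
  upperCovers p = filter (λ x → covers x p ≟ᵇ true) (allFin n)

  Labelling : Set
  Labelling = Fin n → Carrier

  sumL : List Carrier → Carrier
  sumL = foldr _+_ 0#

  -- Σ_{x ∈ P̂, p covers x} f(x)   (with f(0̂) = α)
  down : Labelling → Fin n → Carrier
  down f p = (if minimal p then α else 0#) + sumL (map f (lowerCovers p))

  -- Σ_{x ∈ P̂, x covers p} 1/f(x)   (with f(1̂) = ω)
  upInv : Labelling → Fin n → Carrier
  upInv f p = (if maximal p then ω ⁻¹ else 0#)
              + sumL (map (λ x → f x ⁻¹) (upperCovers p))

  toggle : Fin n → Labelling → Labelling
  toggle p f q with ⌊ q ≟ᶠ p ⌋
  ... | true  = (f p ⁻¹) * down f p * (upInv f p ⁻¹)
  ... | false = f q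

  -- linear extension p_1,…,p_N given as a bijection σ : Fin n → P, i ↦ p_{i+1}
  IsLinearExtension : Permutation′ n → Set
  IsLinearExtension σ = ∀ i j → (σ ⟨$⟩ʳ i) ≼ (σ ⟨$⟩ʳ j) → ¬ ((σ ⟨$⟩ʳ i) ≡ (σ ⟨$⟩ʳ j)) →
                        i <ᶠ j

  row : Permutation′ n → Labelling → Labelling
  row σ = foldr (λ p g → toggle p ∘ g) id (map (σ ⟨$⟩ʳ_) (allFin n))

  iter : ℕ → (Labelling → Labelling) → Labelling → Labelling
  iter zero    g f = f
  iter (suc k) g f = g (iter k g f)

  Positive : Labelling → Set
  Positive f = ∀ p → 0# < f p

  Tplus Tminus T : Fin n → Labelling → Carrier
  Tplus  p f = f p * (down f p ⁻¹)
  Tminus p f = (f p ⁻¹) * (upInv f p ⁻¹)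
  T      p f = Tplus p f * (Tminus p f ⁻¹)

  prodOrbit : Permutation′ n → Fin n → ℕ → Labelling → Carrier
  prodOrbit σ p zero    f = 1#
  prodOrbit σ p (suc k) f = prodOrbit σ p k f * T p (iter k (row σ) f)

-- Along a linear extension, the toggle at p sees the old values below p and the new values
-- above p, so (row f)(p) = f(p)⁻¹ · down f p · (upInv (row f) p)⁻¹, which says exactly that
-- T⁺_p(f) = T⁻_p(row f).  Positivity keeps every denominator nonzero; it needs
-- each non-minimal (non-maximal) element to have a lower (upper) cover, which holds because
-- partial orders on Fin n are well-founded.
module Submission where

open import Defs
open import Level using (0ℓ)
open import Algebra.Bundles using (CommutativeRing)
open import Algebra.Structures using (IsCommutativeRing)
open import Data.Bool using (Bool; true; false; _∧_; if_then_else_) renaming (_≟_ to _≟ᵇ_)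
open import Data.Bool.ListAction using (any)
open import Data.Bool.Properties using (T-≡; ∧-conicalˡ; ∧-conicalʳ; not-injective)
open import Data.Empty using (⊥-elim)
open import Data.Fin using (Fin) renaming (_<_ to _<ᶠ_)
open import Data.Fin.Induction using (po-wellFounded; po-noetherian)
open import Data.Fin.Permutation using (Permutation′; _⟨$⟩ʳ_; _⟨$⟩ˡ_; inverseˡ; inverseʳ)
import Data.Fin.Properties as Fin
open import Data.List using (List; []; _∷_; foldr; map; allFin)
open import Data.List.Membership.Propositional using (_∈_)
open import Data.List.Membership.Propositional.Properties using (∈-allFin; ∈-map⁺; ∈-filter⁺)
open import Data.List.Properties using (map-cong-local)
open import Data.List.Relation.Unary.All as All using (All; []; _∷_)
open import Data.List.Relation.Unary.All.Properties using (all-filter; map⁺)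
open import Data.List.Relation.Unary.AllPairs using (AllPairs; _∷_)
import Data.List.Relation.Unary.AllPairs.Properties as AllPairs
open import Data.List.Relation.Unary.Any using (here; there; satisfied)
open import Data.List.Relation.Unary.Any.Properties using (any⁻)
open import Data.Nat using (ℕ; zero; suc) renaming (_<_ to _<ℕ_)
open import Data.Product as Product using (∃; _×_; _,_; proj₁; proj₂)
open import Data.Sum using (_⊎_; inj₁; inj₂)
open import Function using (id; _∘_; flip; Equivalence)
open import Induction.WellFounded using (Acc; acc)
open import Relation.Binary using (Rel; tri<; tri≈; tri>)
open import Relation.Binary.Structures using (IsDecPartialOrder; IsStrictTotalOrder)
import Relation.Binary.Construct.NonStrictToStrict as ToStrict
open import Relation.Binary.PropositionalEquality using (_≡_; _≢_; refl; sym; trans; cong; cong₂; subst; subst₂; ≢-sym; module ≡-Reasoning)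
open import Relation.Nullary using (¬_; yes; no)

module OrderedFieldProperties (R : RealField) where
  open RealField R
  open IsCommutativeRing isCommutativeRing using
    (*-comm; *-assoc; *-identityˡ; *-identityʳ; zeroʳ; +-comm; +-identityˡ; +-identityʳ; -‿inverseˡ; -‿inverseʳ)
  open IsStrictTotalOrder isStrictTotalOrder using (compare; irrefl) renaming (trans to <-trans)

  private
    ring : CommutativeRing 0ℓ 0ℓ
    ring = record { isCommutativeRing = isCommutativeRing }
  open import Algebra.Properties.Ring (CommutativeRing.ring ring) using (-‿distribˡ-*; -‿distribʳ-*; -‿involutive)
  open import Algebra.Properties.CommutativeSemigroup (CommutativeRing.*-commutativeSemigroup ring) using (interchange)

  x⁻¹*x≡1 : ∀ {x} → x ≢ 0# → x ⁻¹ * x ≡ 1#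
  x⁻¹*x≡1 {x} x≢0 = trans (*-comm _ _) (⁻¹-inverse x x≢0)

  x⁻¹*[x*y]≡y : ∀ {x} y → x ≢ 0# → x ⁻¹ * (x * y) ≡ y
  x⁻¹*[x*y]≡y {x} y x≢0 = trans (sym (*-assoc _ _ _)) (trans (cong (_* y) (x⁻¹*x≡1 x≢0)) (*-identityˡ y))

  *-≢0 : ∀ {x y} → x ≢ 0# → y ≢ 0# → x * y ≢ 0#
  *-≢0 {x} {y} x≢0 y≢0 xy≡0 = y≢0 (begin
    y                 ≡⟨ x⁻¹*[x*y]≡y y x≢0 ⟨
    x ⁻¹ * (x * y)    ≡⟨ cong (x ⁻¹ *_) xy≡0 ⟩
    x ⁻¹ * 0#         ≡⟨ zeroʳ _ ⟩
    0#                ∎)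
    where open ≡-Reasoning

  ⁻¹-≢0 : ∀ {x} → x ≢ 0# → x ⁻¹ ≢ 0#
  ⁻¹-≢0 {x} x≢0 x⁻¹≡0 = 0≢1 (trans (sym (zeroʳ x)) (trans (cong (x *_) (sym x⁻¹≡0)) (⁻¹-inverse x x≢0)))

  ⁻¹-unique : ∀ {x y} → x ≢ 0# → x * y ≡ 1# → y ≡ x ⁻¹
  ⁻¹-unique {x} {y} x≢0 xy≡1 = trans (sym (x⁻¹*[x*y]≡y y x≢0)) (trans (cong (x ⁻¹ *_) xy≡1) (*-identityʳ _))

  ⁻¹-involutive : ∀ {x} → x ≢ 0# → x ⁻¹ ⁻¹ ≡ x
  ⁻¹-involutive x≢0 = sym (⁻¹-unique (⁻¹-≢0 x≢0) (x⁻¹*x≡1 x≢0))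

  ⁻¹-distrib-* : ∀ {x y} → x ≢ 0# → y ≢ 0# → (x * y) ⁻¹ ≡ x ⁻¹ * y ⁻¹
  ⁻¹-distrib-* {x} {y} x≢0 y≢0 = sym (⁻¹-unique (*-≢0 x≢0 y≢0) (begin
    (x * y) * (x ⁻¹ * y ⁻¹)       ≡⟨ interchange x y (x ⁻¹) (y ⁻¹) ⟩
    (x * x ⁻¹) * (y * y ⁻¹)       ≡⟨ cong₂ _*_ (⁻¹-inverse x x≢0) (⁻¹-inverse y y≢0) ⟩
    1# * 1#                       ≡⟨ *-identityˡ 1# ⟩
    1#                            ∎))
    where open ≡-Reasoning

  [x⁻¹*y*z⁻¹]⁻¹*z⁻¹≡x*y⁻¹ : ∀ {x y z} → x ≢ 0# → y ≢ 0# → z ≢ 0# →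
                            (x ⁻¹ * y * z ⁻¹) ⁻¹ * z ⁻¹ ≡ x * y ⁻¹
  [x⁻¹*y*z⁻¹]⁻¹*z⁻¹≡x*y⁻¹ {x} {y} {z} x≢0 y≢0 z≢0 = begin
    (x ⁻¹ * y * z ⁻¹) ⁻¹ * z ⁻¹        ≡⟨ cong (_* z ⁻¹) (⁻¹-distrib-* (*-≢0 (⁻¹-≢0 x≢0) y≢0) (⁻¹-≢0 z≢0)) ⟩
    (x ⁻¹ * y) ⁻¹ * z ⁻¹ ⁻¹ * z ⁻¹     ≡⟨ *-assoc _ _ _ ⟩
    (x ⁻¹ * y) ⁻¹ * (z ⁻¹ ⁻¹ * z ⁻¹)   ≡⟨ cong ((x ⁻¹ * y) ⁻¹ *_) (x⁻¹*x≡1 (⁻¹-≢0 z≢0)) ⟩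
    (x ⁻¹ * y) ⁻¹ * 1#                 ≡⟨ *-identityʳ _ ⟩
    (x ⁻¹ * y) ⁻¹                      ≡⟨ ⁻¹-distrib-* (⁻¹-≢0 x≢0) y≢0 ⟩
    x ⁻¹ ⁻¹ * y ⁻¹                     ≡⟨ cong (_* y ⁻¹) (⁻¹-involutive x≢0) ⟩
    x * y ⁻¹                           ∎
    where open ≡-Reasoning

  x*y⁻¹*[z*x⁻¹]≡z*y⁻¹ : ∀ {x y z} → x ≢ 0# → (x * y ⁻¹) * (z * x ⁻¹) ≡ z * y ⁻¹
  x*y⁻¹*[z*x⁻¹]≡z*y⁻¹ {x} {y} {z} x≢0 = begin
    (x * y ⁻¹) * (z * x ⁻¹)    ≡⟨ cong (_* (z * x ⁻¹)) (*-comm x (y ⁻¹)) ⟩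
    (y ⁻¹ * x) * (z * x ⁻¹)    ≡⟨ interchange (y ⁻¹) x z (x ⁻¹) ⟩
    (y ⁻¹ * z) * (x * x ⁻¹)    ≡⟨ cong ((y ⁻¹ * z) *_) (⁻¹-inverse x x≢0) ⟩
    (y ⁻¹ * z) * 1#            ≡⟨ *-identityʳ _ ⟩
    y ⁻¹ * z                   ≡⟨ *-comm _ _ ⟩
    z * y ⁻¹                   ∎
    where open ≡-Reasoning

  pos⇒≢0 : ∀ {x} → 0# < x → x ≢ 0#
  pos⇒≢0 0<x refl = irrefl refl 0<x

  neg⇒-pos : ∀ {x} → x < 0# → 0# < - x
  neg⇒-pos {x} x<0 = subst₂ _<_ (-‿inverseʳ x) (+-identityˡ (- x)) (+-mono-< (- x) x<0)

  0<1 : 0# < 1#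
  0<1 with compare 0# 1#
  ... | tri< 0<1 _ _ = 0<1
  ... | tri≈ _ 0≡1 _ = ⊥-elim (0≢1 0≡1)
  ... | tri> _ _ 1<0 =
    ⊥-elim (irrefl refl (<-trans (subst (0# <_) [-1]*[-1]≡1 (*-pos (neg⇒-pos 1<0) (neg⇒-pos 1<0))) 1<0))
    where
      [-1]*[-1]≡1 : (- 1#) * (- 1#) ≡ 1#
      [-1]*[-1]≡1 = trans (sym (-‿distribˡ-* 1# (- 1#))) (trans (cong -_ (*-identityˡ (- 1#))) (-‿involutive 1#))

  ⁻¹-pos : ∀ {x} → 0# < x → 0# < x ⁻¹
  ⁻¹-pos {x} 0<x with compare 0# (x ⁻¹)
  ... | tri< 0<x⁻¹ _ _ = 0<x⁻¹
  ... | tri≈ _ 0≡x⁻¹ _ = ⊥-elim (⁻¹-≢0 (pos⇒≢0 0<x) (sym 0≡x⁻¹))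
  ... | tri> _ _ x⁻¹<0 = ⊥-elim (irrefl refl (<-trans 0<1 1<0))
    where
      0<-1 : 0# < - 1#
      0<-1 = subst (0# <_) (trans (sym (-‿distribʳ-* x (x ⁻¹))) (cong -_ (⁻¹-inverse x (pos⇒≢0 0<x))))
                   (*-pos 0<x (neg⇒-pos x⁻¹<0))
      1<0 : 1# < 0#
      1<0 = subst₂ _<_ (+-identityˡ 1#) (-‿inverseˡ 1#) (+-mono-< 1# 0<-1)

  +-pos : ∀ {x y} → 0# < x → 0# < y → 0# < x + y
  +-pos {x} {y} 0<x 0<y =
    subst (0# <_) (+-comm y x) (<-trans 0<x (subst (_< y + x) (+-identityˡ x) (+-mono-< x 0<y)))

  +-pos-nonneg : ∀ {x y} → 0# < x → 0# ≤ y → 0# < x + y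
  +-pos-nonneg 0<x (inj₁ 0<y)  = +-pos 0<x 0<y
  +-pos-nonneg 0<x (inj₂ refl) = subst (0# <_) (sym (+-identityʳ _)) 0<x

  +-nonneg-pos : ∀ {x y} → 0# ≤ x → 0# < y → 0# < x + y
  +-nonneg-pos {x} {y} 0≤x 0<y = subst (0# <_) (+-comm y x) (+-pos-nonneg 0<y 0≤x)

  sum-nonneg : ∀ {xs} → All (0# <_) xs → 0# ≤ foldr _+_ 0# xs
  sum-nonneg []           = inj₂ refl
  sum-nonneg (0<x ∷ 0<xs) = inj₁ (+-pos-nonneg 0<x (sum-nonneg 0<xs))

  sum-pos : ∀ {x xs} → x ∈ xs → All (0# <_) xs → 0# < foldr _+_ 0# xs
  sum-pos _ (0<x ∷ 0<xs) = +-pos-nonneg 0<x (sum-nonneg 0<xs)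

module RowmotionProperties (R : RealField) {n : ℕ} (_≼_ : Rel (Fin n) 0ℓ)
                           (isDPO : IsDecPartialOrder _≡_ _≼_) (α ω : RealField.Carrier R) where
  open RealField R
  open Rowmotion R _≼_ isDPO α ω
  open OrderedFieldProperties R
  open IsDecPartialOrder isDPO using (isPartialOrder; reflexive) renaming (_≤?_ to _≼?_)

  _≺_ : Rel (Fin n) 0ℓ
  _≺_ = ToStrict._<_ _≡_ _≼_

  lt⇒≺ : ∀ {x y} → lt x y ≡ true → x ≺ y
  lt⇒≺ {x} {y} x<y with x ≼? y | x Fin.≟ y
  lt⇒≺ _  | yes x≼y | no x≢y = x≼y , x≢y
  lt⇒≺ () | yes _   | yes _
  lt⇒≺ () | no _    | _

  any-witness : ∀ (P : Fin n → Bool) → any P (allFin n) ≡ true → ∃ λ x → P x ≡ true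
  any-witness P h = Product.map₂ (Equivalence.to T-≡) (satisfied (any⁻ P (allFin n) (Equivalence.from T-≡ h)))

  covers-or-between : ∀ {p x} → lt x p ≡ true →
                      covers p x ≡ true ⊎ ∃ λ z → lt x z ≡ true × lt z p ≡ true
  covers-or-between {p} {x} x<p with any (λ z → lt x z ∧ lt z p) (allFin n) in between
  ... | true  = let z , x<z<p = any-witness _ between
                in  inj₂ (z , ∧-conicalˡ (lt x z) (lt z p) x<z<p , ∧-conicalʳ (lt x z) (lt z p) x<z<p)
  ... | false = inj₁ (cong (_∧ true) x<p)

  lowerCover-exists : ∀ {p x} → Acc (flip _≺_) x → lt x p ≡ true → ∃ λ y → covers p y ≡ true
  lowerCover-exists (acc rs) x<p with covers-or-between x<p
  ... | inj₁ p⋗x             = _ , p⋗x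
  ... | inj₂ (z , x<z , z<p) = lowerCover-exists (rs (lt⇒≺ x<z)) z<p

  upperCover-exists : ∀ {p x} → Acc _≺_ x → lt p x ≡ true → ∃ λ y → covers y p ≡ true
  upperCover-exists (acc rs) p<x with covers-or-between p<x
  ... | inj₁ x⋗p             = _ , x⋗p
  ... | inj₂ (z , p<z , z<x) = upperCover-exists (rs (lt⇒≺ z<x)) p<z

  lowerCover∈ : ∀ {p y} → covers p y ≡ true → y ∈ lowerCovers p
  lowerCover∈ {p} {y} = ∈-filter⁺ (λ x → covers p x ≟ᵇ true) (∈-allFin y)

  upperCover∈ : ∀ {p y} → covers y p ≡ true → y ∈ upperCovers p
  upperCover∈ {p} {y} = ∈-filter⁺ (λ x → covers x p ≟ᵇ true) (∈-allFin y)

  ¬minimal⇒lowerCover : ∀ p → minimal p ≡ false → ∃ λ y → y ∈ lowerCovers p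
  ¬minimal⇒lowerCover p ¬min =
    let x , x<p = any-witness (λ x → lt x p) (not-injective ¬min)
    in  Product.map₂ lowerCover∈ (lowerCover-exists (po-noetherian isPartialOrder x) x<p)

  ¬maximal⇒upperCover : ∀ p → maximal p ≡ false → ∃ λ y → y ∈ upperCovers p
  ¬maximal⇒upperCover p ¬max =
    let x , p<x = any-witness (λ x → lt p x) (not-injective ¬max)
    in  Product.map₂ upperCover∈ (upperCover-exists (po-wellFounded isPartialOrder x) p<x)

  lowerCover⇒≺ : ∀ {p x} → x ∈ lowerCovers p → x ≺ p
  lowerCover⇒≺ {p} x∈ = lt⇒≺ (∧-conicalˡ _ _ (All.lookup (all-filter (λ x → covers p x ≟ᵇ true) (allFin n)) x∈))

  upperCover⇒≻ : ∀ {p y} → y ∈ upperCovers p → p ≺ y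
  upperCover⇒≻ {p} y∈ = lt⇒≺ (∧-conicalˡ _ _ (All.lookup (all-filter (λ x → covers x p ≟ᵇ true) (allFin n)) y∈))

  down-cong : ∀ {g h p} → All (λ x → g x ≡ h x) (lowerCovers p) → down g p ≡ down h p
  down-cong g≡h = cong (_ +_) (cong sumL (map-cong-local g≡h))

  upInv-cong : ∀ {g h p} → All (λ x → g x ≡ h x) (upperCovers p) → upInv g p ≡ upInv h p
  upInv-cong g≡h = cong (_ +_) (cong sumL (map-cong-local (All.map (cong _⁻¹) g≡h)))

  Tminus-cong : ∀ {g h} → (∀ q → g q ≡ h q) → ∀ p → Tminus p g ≡ Tminus p h
  Tminus-cong g≡h p = cong₂ (λ a u → a ⁻¹ * u ⁻¹) (g≡h p) (upInv-cong (All.universal g≡h _))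

  toggle-≢ : ∀ {p q} f → q ≢ p → toggle p f q ≡ f q
  toggle-≢ {p} {q} f q≢p with q Fin.≟ p
  ... | yes q≡p = ⊥-elim (q≢p q≡p)
  ... | no _    = refl

  toggle-self : ∀ {p} f → toggle p f p ≡ f p ⁻¹ * down f p * upInv f p ⁻¹
  toggle-self {p} f with p Fin.≟ p
  ... | yes _   = refl
  ... | no p≢p  = ⊥-elim (p≢p refl)

  toggles : List (Fin n) → Labelling → Labelling
  toggles = foldr (λ p g → toggle p ∘ g) id

  toggles-≢ : ∀ {ps q} f → All (_≢ q) ps → toggles ps f q ≡ f q
  toggles-≢ f []            = refl
  toggles-≢ f (p≢q ∷ ps≢q) = trans (toggle-≢ _ (≢-sym p≢q)) (toggles-≢ f ps≢q)

  ⋠⇒≢ : ∀ {b x p} → ¬ b ≼ p → x ≼ p → b ≢ x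
  ⋠⇒≢ b⋠p x≼p refl = b⋠p x≼p

  -- toggles applies the list from right to left, so the ordering hypothesis says: when p is
  -- toggled, nothing toggled earlier lies below p and nothing toggled later lies above p.
  toggles-at : ∀ {ps p} f → AllPairs (λ a b → ¬ b ≼ a) ps → p ∈ ps →
               toggles ps f p ≡ f p ⁻¹ * down f p * upInv (toggles ps f) p ⁻¹
  toggles-at {p ∷ ps} f (ps⋠p ∷ _) (here refl) = begin
    toggle p g p                               ≡⟨ toggle-self g ⟩
    g p ⁻¹ * down g p * upInv g p ⁻¹           ≡⟨ cong₂ (λ a d → a ⁻¹ * d * upInv g p ⁻¹) g-at-p (down-cong g-below-p) ⟩
    f p ⁻¹ * down f p * upInv g p ⁻¹           ≡⟨ cong (λ u → f p ⁻¹ * down f p * u ⁻¹) (upInv-cong g-above-p) ⟩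
    f p ⁻¹ * down f p * upInv (toggle p g) p ⁻¹ ∎
    where
      open ≡-Reasoning
      g = toggles ps f
      untouched : ∀ {x} → x ≼ p → g x ≡ f x
      untouched x≼p = toggles-≢ f (All.map (λ b⋠p → ⋠⇒≢ b⋠p x≼p) ps⋠p)
      g-at-p : g p ≡ f p
      g-at-p = untouched (reflexive refl)
      g-below-p : All (λ x → g x ≡ f x) (lowerCovers p)
      g-below-p = All.tabulate (untouched ∘ proj₁ ∘ lowerCover⇒≺)
      g-above-p : All (λ y → g y ≡ toggle p g y) (upperCovers p)
      g-above-p = All.tabulate (λ y∈ → sym (toggle-≢ g (≢-sym (proj₂ (upperCover⇒≻ y∈)))))
  toggles-at {i ∷ ps} {p} f (ps⋠i ∷ ps-ordered) (there p∈ps) = begin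
    toggle i h p                                ≡⟨ toggle-≢ h (⋠⇒≢ p⋠i (reflexive refl)) ⟩
    h p                                         ≡⟨ toggles-at f ps-ordered p∈ps ⟩
    f p ⁻¹ * down f p * upInv h p ⁻¹            ≡⟨ cong (λ u → f p ⁻¹ * down f p * u ⁻¹) (upInv-cong h-above-p) ⟩
    f p ⁻¹ * down f p * upInv (toggle i h) p ⁻¹ ∎
    where
      open ≡-Reasoning
      h = toggles ps f
      p⋠i : ¬ p ≼ i
      p⋠i = All.lookup ps⋠i p∈ps
      h-above-p : All (λ y → h y ≡ toggle i h y) (upperCovers p)
      h-above-p = All.tabulate (λ y∈ → sym (toggle-≢ h λ { refl → p⋠i (proj₁ (upperCover⇒≻ y∈)) }))

  linearExtension-ordered : ∀ {σ} → IsLinearExtension σ → AllPairs (λ a b → ¬ b ≼ a) (map (σ ⟨$⟩ʳ_) (allFin n))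
  linearExtension-ordered {σ} lin = AllPairs.map⁺ (AllPairs.tabulate⁺-< later⋠earlier)
    where
      later⋠earlier : ∀ {i j} → i <ᶠ j → ¬ (σ ⟨$⟩ʳ j) ≼ (σ ⟨$⟩ʳ i)
      later⋠earlier {i} {j} i<j σj≼σi = Fin.<-asym i<j (lin j i σj≼σi σj≢σi)
        where
          σj≢σi : σ ⟨$⟩ʳ j ≢ σ ⟨$⟩ʳ i
          σj≢σi e = Fin.<⇒≢ i<j (trans (sym (inverseˡ σ)) (trans (cong (σ ⟨$⟩ˡ_) (sym e)) (inverseˡ σ)))

  row-at : ∀ {σ} → IsLinearExtension σ → ∀ f p → row σ f p ≡ f p ⁻¹ * down f p * upInv (row σ f) p ⁻¹
  row-at {σ} lin f p = toggles-at f (linearExtension-ordered {σ} lin) p∈σ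
    where
      p∈σ : p ∈ map (σ ⟨$⟩ʳ_) (allFin n)
      p∈σ = subst (_∈ map (σ ⟨$⟩ʳ_) (allFin n)) (inverseʳ σ) (∈-map⁺ (σ ⟨$⟩ʳ_) (∈-allFin (σ ⟨$⟩ˡ p)))

  module Positivity (0<α : 0# < α) (0<ω : 0# < ω) where

    boundary+sum-pos : ∀ {b c} {g : Fin n → Carrier} {xs} → 0# < c → (∀ x → 0# < g x) →
                       (b ≡ false → ∃ λ y → y ∈ xs) → 0# < (if b then c else 0#) + sumL (map g xs)
    boundary+sum-pos {true}  {xs = xs} 0<c g>0 _ = +-pos-nonneg 0<c (sum-nonneg (map⁺ (All.universal g>0 xs)))
    boundary+sum-pos {false} {g = g} {xs} _ g>0 nonempty =
      let _ , y∈xs = nonempty refl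
      in  +-nonneg-pos (inj₂ refl) (sum-pos (∈-map⁺ g y∈xs) (map⁺ (All.universal g>0 xs)))

    down-pos : ∀ {f} → Positive f → ∀ p → 0# < down f p
    down-pos f>0 p = boundary+sum-pos 0<α f>0 (¬minimal⇒lowerCover p)

    upInv-pos : ∀ {f} → Positive f → ∀ p → 0# < upInv f p
    upInv-pos f>0 p = boundary+sum-pos (⁻¹-pos 0<ω) (⁻¹-pos ∘ f>0) (¬maximal⇒upperCover p)

    toggle-pos : ∀ {f} p → Positive f → Positive (toggle p f)
    toggle-pos p f>0 q with q Fin.≟ p
    ... | yes refl = *-pos (*-pos (⁻¹-pos (f>0 q)) (down-pos f>0 q)) (⁻¹-pos (upInv-pos f>0 q))
    ... | no _     = f>0 q

    toggles-pos : ∀ {f} ps → Positive f → Positive (toggles ps f)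
    toggles-pos []       f>0 = f>0
    toggles-pos (p ∷ ps) f>0 = toggle-pos p (toggles-pos ps f>0)

    Tminus-≢0 : ∀ {f} → Positive f → ∀ p → Tminus p f ≢ 0#
    Tminus-≢0 f>0 p = *-≢0 (⁻¹-≢0 (pos⇒≢0 (f>0 p))) (⁻¹-≢0 (pos⇒≢0 (upInv-pos f>0 p)))

    module Orbit {σ} (lin : IsLinearExtension σ) where

      row-pos : ∀ {f} → Positive f → Positive (row σ f)
      row-pos = toggles-pos (map (σ ⟨$⟩ʳ_) (allFin n))

      iter-row-pos : ∀ {f} k → Positive f → Positive (iter k (row σ) f)
      iter-row-pos zero    f>0 = f>0
      iter-row-pos (suc k) f>0 = row-pos (iter-row-pos k f>0)

      Tplus≡Tminus∘row : ∀ {f} → Positive f → ∀ p → Tplus p f ≡ Tminus p (row σ f)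
      Tplus≡Tminus∘row {f} f>0 p = sym (begin
        row σ f p ⁻¹ * U ⁻¹                   ≡⟨ cong (λ a → a ⁻¹ * U ⁻¹) (row-at {σ} lin f p) ⟩
        (f p ⁻¹ * down f p * U ⁻¹) ⁻¹ * U ⁻¹  ≡⟨ [x⁻¹*y*z⁻¹]⁻¹*z⁻¹≡x*y⁻¹ (pos⇒≢0 (f>0 p)) (pos⇒≢0 (down-pos f>0 p))
                                                   (pos⇒≢0 (upInv-pos (row-pos f>0) p)) ⟩
        f p * down f p ⁻¹                     ∎)
        where
          open ≡-Reasoning
          U = upInv (row σ f) p

      prodOrbit-telescopes : ∀ {f} → Positive f → ∀ p k →
                             prodOrbit σ p k f ≡ Tminus p (iter k (row σ) f) * Tminus p f ⁻¹
      prodOrbit-telescopes f>0 p zero    = sym (⁻¹-inverse _ (Tminus-≢0 f>0 p))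
      prodOrbit-telescopes {f} f>0 p (suc k) = begin
        prodOrbit σ p k f * T p g                                  ≡⟨ cong (_* T p g) (prodOrbit-telescopes f>0 p k) ⟩
        Tminus p g * Tminus p f ⁻¹ * (Tplus p g * Tminus p g ⁻¹)  ≡⟨ cong (λ t → Tminus p g * Tminus p f ⁻¹ * (t * Tminus p g ⁻¹))
                                                                        (Tplus≡Tminus∘row g>0 p) ⟩
        Tminus p g * Tminus p f ⁻¹ * (Tminus p (row σ g) * Tminus p g ⁻¹)
                                                                   ≡⟨ x*y⁻¹*[z*x⁻¹]≡z*y⁻¹ (Tminus-≢0 g>0 p) ⟩
        Tminus p (row σ g) * Tminus p f ⁻¹                         ∎
        where
          open ≡-Reasoning
          g = iter k (row σ) f
          g>0 = iter-row-pos k f>0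

lemma4p42 : (R : RealField) → let open RealField R in
  (n : ℕ) (_≼_ : Rel (Fin n) 0ℓ) (isDPO : IsDecPartialOrder _≡_ _≼_)
  (α ω : Carrier) → 0# < α → 0# < ω →
  let open Rowmotion R _≼_ isDPO α ω in
  (σ : Permutation′ n) → IsLinearExtension σ →
  (f : Labelling) → Positive f →
  (k : ℕ) → 0 <ℕ k →
  (∀ q → iter k (row σ) f q ≡ f q) →
  (∀ j → 0 <ℕ j → j <ℕ k → ¬ (∀ q → iter j (row σ) f q ≡ f q)) →
  ∀ p → prodOrbit σ p k f ≡ 1#
lemma4p42 R n _≼_ isDPO α ω 0<α 0<ω σ lin f f>0 k _ periodic _ p = begin
  prodOrbit σ p k f                             ≡⟨ prodOrbit-telescopes f>0 p k ⟩
  Tminus p (iter k (row σ) f) * Tminus p f ⁻¹   ≡⟨ cong (_* Tminus p f ⁻¹) (Tminus-cong periodic p) ⟩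
  Tminus p f * Tminus p f ⁻¹                    ≡⟨ ⁻¹-inverse _ (Tminus-≢0 f>0 p) ⟩
  1#                                            ∎
  where
    open RealField R
    open Rowmotion R _≼_ isDPO α ω
    open RowmotionProperties R _≼_ isDPO α ω
    open Positivity 0<α 0<ω
    open Orbit lin
    open ≡-Reasoning
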